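{- Let $A,B$ be nonzero integers, $g=\gcd(A,B)$, and for a positive integer $L$ let $\ell=\prod_{p\nmid g}p^{\nu_p(L)}$ and $\gamma(L)=\max_{p\mid g}\lceil\nu_p(L)/\nu_p(g)\rceil$ (with $\gamma(L)=0$ if $g=1$). If $\ell=1$, then $L\in G_{(A,B)}$ if and only if there exists a positive integer $K\ge\gamma(L)$. In this case, $L\in G_{(A,B)}$ and every positive integer $K\ge\gamma(L)$ satisfies $L\mid (A^K+B^K)$.
   Context: A positive integer $M$ is good with respect to nonzero integers $X,Y$ if $M\mid (X^K+Y^K)$ for some positive integer $K$; $G_{(X,Y)}$ is the set of such good integers. $\nu_p$ is the $p$-adic valuation. -}

module Defs where

open import Data.Nat as ℕ using (ℕ; zero; suc; _+_; _*_; _^_; _/_; _⊔_; _≤_)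
open import Data.Nat.Divisibility using (_∣?_)
open import Data.Nat.GCD using (gcd)
open import Data.Nat.Primality using (prime?)
open import Data.List using (List; upTo; filter; length; map; foldr)
open import Data.Nat.ListAction using (product)
open import Data.Product using (∃; _×_)
open import Relation.Nullary using (¬?)
open import Data.Integer as ℤ using (ℤ; +_)
import Data.Integer.Divisibility as ℤDiv

-- p-adic valuation of n (meaningful for p ≥ 2, n ≥ 1):
-- the number of k ∈ {1,…,n} with p^k ∣ n.  Since p^k ∣ n ≥ 1 forces k < n,
-- this equals max { k | p^k ∣ n }.
ν : ℕ → ℕ → ℕ
ν p n = length (filter (λ k → (p ^ suc k) ∣? n) (upTo n))

primesUpTo : ℕ → List ℕ
primesUpTo n = filter prime? (upTo (suc n))

-- ceiling division ⌈a / b⌉ (b = 0 gives 0, never used at b = 0)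
⌈_/_⌉ : ℕ → ℕ → ℕ
⌈ a / zero ⌉ = 0
⌈ a / suc b ⌉ = (a + b) / suc b

gcdℤ : ℤ → ℤ → ℕ
gcdℤ A B = gcd (ℤ.∣ A ∣) (ℤ.∣ B ∣)

-- ℓ = ∏_{p prime, p ∤ g} p^{ν_p(L)}  (primes dividing L are ≤ L)
ℓ : ℕ → ℕ → ℕ
ℓ g L = product (map (λ p → p ^ ν p L) (filter (λ p → ¬? (p ∣? g)) (primesUpTo L)))

-- γ(L) = max_{p prime, p ∣ g} ⌈ν_p(L)/ν_p(g)⌉ (= 0 if g = 1); primes dividing g are ≤ g
γ : ℕ → ℕ → ℕ
γ g L = foldr _⊔_ 0 (map (λ p → ⌈ ν p L / ν p g ⌉) (filter (λ p → p ∣? g) (primesUpTo g)))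

-- M ∈ G_(X,Y): M ∣ X^K + Y^K for some positive integer K
Good : ℤ → ℤ → ℕ → Set
Good X Y M = ∃ λ K → 1 ≤ K × (+ M) ℤDiv.∣ (X ℤ.^ K ℤ.+ Y ℤ.^ K)

{-# OPTIONS --safe #-}
-- ℓ(L) = 1 says that every prime factor p of L divides g, and γ(L) ≤ K says
-- that ν_p(L) ≤ K ν_p(g) for each of them.  Hence every prime power dividing L
-- divides g^K, so L ∣ g^K; and g^K divides both A^K and B^K.  Both sides of the
-- equivalence are then witnessed by K = γ(L) + 1.
module Submission where

open import Defs
open import Data.Nat using (ℕ; suc; _≤_; z≤n; s≤s; NonZero; >-nonZero)
open import Data.Nat.Properties using (n≤1+n)
open import Data.Product using (∃; _×_; _,_)
open import Relation.Binary.PropositionalEquality using (_≡_; _≢_)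
open import Function.Bundles using (_⇔_; mk⇔)

-- ℕ arithmetic is opened only in this block, since the theorem uses the ℤ
-- operators of the same names.
module _ where
  open import Data.Nat
    using (zero; suc; _+_; _*_; _∸_; _^_; _%_; _<_; _≰_; _⊔_; z≤n; s≤s; z<s;
           NonZero; ≢-nonZero; >-nonZero; nonTrivial⇒n>1)
  open import Data.Nat.Properties
  open import Data.Nat.Divisibility
  open import Data.Nat.DivMod using (m≡m%n+[m/n]*n; m%n<n)
  open import Data.Nat.GCD using (gcd[m,n]∣m; gcd[m,n]∣n; gcd[m,n]≢0)
  open import Data.Nat.Primality
  open import Data.Nat.Primality.Factorisation using (PrimeFactorisation; factorise)
  open import Data.Nat.ListAction using (product)
  open import Data.Nat.ListAction.Properties using (∈⇒∣product)
  open import Data.List using ([]; _∷_; filter; length; applyUpTo; foldr)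
  open import Data.List.Relation.Unary.All using (All; []; _∷_)
  open import Data.List.Relation.Unary.Any using (here; there)
  open import Data.List.Membership.Propositional using (_∈_)
  open import Data.List.Membership.Propositional.Properties
    using (∈-filter⁺; ∈-map⁺; ∈-upTo⁺)
  open import Data.Sum using (inj₁; inj₂)
  open import Function using (_∘_; id)
  open import Relation.Binary.PropositionalEquality using (refl; sym; trans; cong; subst)
  open import Relation.Nullary using (¬_; ¬?; yes; no; contradiction)
  open import Relation.Unary using (Decidable)
  open import Algebra.Properties.CommutativeSemigroup *-commutativeSemigroup
    using (x∙yz≈y∙xz)
  import Data.Integer as ℤ
  import Data.Integer.Properties as ℤ
  import Data.Integer.Divisibility as ℤ
  import Data.Integer.Divisibility.Signed as ℤˢ

  module _ {P : ℕ → Set} (P? : Decidable P) where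

    length-filter-applyUpTo-≥ : ∀ f {n k} → k ≤ n → (∀ {i} → i < k → P (f i)) →
                                k ≤ length (filter P? (applyUpTo f n))
    length-filter-applyUpTo-≥ f z≤n _ = z≤n
    length-filter-applyUpTo-≥ f {suc _} (s≤s k≤n) P[f<k] with P? (f 0)
    ... | no ¬P[f0] = contradiction (P[f<k] z<s) ¬P[f0]
    ... | yes _ = s≤s (length-filter-applyUpTo-≥ (f ∘ suc) k≤n (P[f<k] ∘ s≤s))

    length-filter-applyUpTo-≤ : ∀ f n {j} → (∀ {i} → P (f i) → i < j) →
                                length (filter P? (applyUpTo f n)) ≤ j
    length-filter-applyUpTo-≤ f zero _ = z≤n
    length-filter-applyUpTo-≤ f (suc n) P[f]⇒<j with P? (f 0)
    ... | no _ = length-filter-applyUpTo-≤ (f ∘ suc) n (<-trans (n<1+n _) ∘ P[f]⇒<j)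
    ... | yes P[f0] with s≤s _ ← P[f]⇒<j P[f0] =
      s≤s (length-filter-applyUpTo-≤ (f ∘ suc) n (≤-pred ∘ P[f]⇒<j))

  ^-monoˡ-∣ : ∀ {m o} n → m ∣ o → m ^ n ∣ o ^ n
  ^-monoˡ-∣ zero    _   = ∣-refl
  ^-monoˡ-∣ (suc n) m∣o = *-pres-∣ m∣o (^-monoˡ-∣ n m∣o)

  ^-monoʳ-∣ : ∀ m {n o} → n ≤ o → m ^ n ∣ m ^ o
  ^-monoʳ-∣ m {n} {o} n≤o = begin
    m ^ n                 ∣⟨ m∣m*n (m ^ (o ∸ n)) ⟩
    m ^ n * m ^ (o ∸ n)   ≡⟨ ^-distribˡ-+-* m n (o ∸ n) ⟨
    m ^ (n + (o ∸ n))     ≡⟨ cong (m ^_) (m+[n∸m]≡n n≤o) ⟩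
    m ^ o                 ∎
    where open ∣-Reasoning

  n<m^n : ∀ m → 1 < m → ∀ n → n < m ^ n
  n<m^n m 1<m zero    = z<s
  n<m^n m 1<m (suc n) = begin
    2 + n                ≤⟨ +-mono-≤ (≤-trans (s≤s z≤n) ih) ih ⟩
    m ^ n + m ^ n        ≡⟨ cong (m ^ n +_) (+-identityʳ (m ^ n)) ⟨
    2 * m ^ n            ≤⟨ *-monoˡ-≤ (m ^ n) 1<m ⟩
    m ^ suc n            ∎
    where
    open ≤-Reasoning
    ih : n < m ^ n
    ih = n<m^n m 1<m n

  p^ν∣n : ∀ p n → p ^ ν p n ∣ n
  p^ν∣n p n with ν p n in ν≡
  ... | zero  = 1∣ n
  ... | suc c with p ^ suc c ∣? n
  ...   | yes p^[1+c]∣n = p^[1+c]∣n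
  ...   | no  p^[1+c]∤n = contradiction ν≤c (subst (_≰ c) (sym ν≡) 1+n≰n)
    where
    below-c : ∀ {i} → p ^ suc i ∣ n → i < c
    below-c p^[1+i]∣n = ≰⇒> λ c≤i → p^[1+c]∤n (∣-trans (^-monoʳ-∣ p (s≤s c≤i)) p^[1+i]∣n)
    ν≤c : ν p n ≤ c
    ν≤c = length-filter-applyUpTo-≤ (λ i → p ^ suc i ∣? n) id n below-c

  p^k∣n⇒k≤ν : ∀ {p n k} → 1 < p → .{{NonZero n}} → p ^ k ∣ n → k ≤ ν p n
  p^k∣n⇒k≤ν {p} {n} {k} 1<p p^k∣n =
    length-filter-applyUpTo-≥ (λ i → p ^ suc i ∣? n) id
      (<⇒≤ (<-≤-trans (n<m^n p 1<p k) (∣⇒≤ p^k∣n)))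
      (λ i<k → ∣-trans (^-monoʳ-∣ p i<k) p^k∣n)

  p∣n⇒1≤ν : ∀ {p n} → 1 < p → .{{NonZero n}} → p ∣ n → 1 ≤ ν p n
  p∣n⇒1≤ν {p} 1<p p∣n = p^k∣n⇒k≤ν 1<p (subst (_∣ _) (sym (^-identityʳ p)) p∣n)

  m≤⌈m/n⌉*n : ∀ m n .{{_ : NonZero n}} → m ≤ ⌈ m / n ⌉ * n
  m≤⌈m/n⌉*n m (suc b) = +-cancelˡ-≤ b m (⌈ m / suc b ⌉ * suc b) (begin
    b + m                                      ≡⟨ +-comm b m ⟩
    m + b                                      ≡⟨ m≡m%n+[m/n]*n (m + b) (suc b) ⟩
    (m + b) % suc b + ⌈ m / suc b ⌉ * suc b    ≤⟨ +-monoˡ-≤ _ (≤-pred (m%n<n (m + b) (suc b))) ⟩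
    b + ⌈ m / suc b ⌉ * suc b                  ∎)
    where open ≤-Reasoning

  ∈⇒≤foldr-⊔ : ∀ {n ns} → n ∈ ns → n ≤ foldr _⊔_ 0 ns
  ∈⇒≤foldr-⊔ (here refl)              = m≤m⊔n _ _
  ∈⇒≤foldr-⊔ {ns = m ∷ _} (there n∈ns) = ≤-trans (∈⇒≤foldr-⊔ n∈ns) (m≤n⊔m m _)

  ∈-primesUpTo : ∀ {p n} → Prime p → p ≤ n → p ∈ primesUpTo n
  ∈-primesUpTo p-prime p≤n = ∈-filter⁺ prime? (∈-upTo⁺ (s≤s p≤n)) p-prime

  ⌈ν/ν⌉≤γ : ∀ {p} g L .{{_ : NonZero g}} → Prime p → p ∣ g → ⌈ ν p L / ν p g ⌉ ≤ γ g L
  ⌈ν/ν⌉≤γ g L p-prime p∣g = ∈⇒≤foldr-⊔ (∈-map⁺ (λ q → ⌈ ν q L / ν q g ⌉)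
    (∈-filter⁺ (_∣? g) (∈-primesUpTo p-prime (∣⇒≤ p∣g)) p∣g))

  p^ν∣ℓ : ∀ {p} g L .{{_ : NonZero L}} → Prime p → ¬ p ∣ g → p ∣ L → p ^ ν p L ∣ ℓ g L
  p^ν∣ℓ g L p-prime p∤g p∣L = ∈⇒∣product (∈-map⁺ (λ q → q ^ ν q L)
    (∈-filter⁺ (¬? ∘ (_∣? g)) (∈-primesUpTo p-prime (∣⇒≤ p∣L)) p∤g))

  prime⇒1<p : ∀ {p} → Prime p → 1 < p
  prime⇒1<p {p} p-prime = nonTrivial⇒n>1 p {{prime⇒nonTrivial p-prime}}

  ℓ≡1⇒∣g : ∀ {p} g L .{{_ : NonZero L}} → ℓ g L ≡ 1 → Prime p → p ∣ L → p ∣ g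
  ℓ≡1⇒∣g {p} g L ℓ≡1 p-prime p∣L with p ∣? g
  ... | yes p∣g = p∣g
  ... | no  p∤g with m^n≡1⇒n≡0∨m≡1 p (ν p L)
                      (∣1⇒≡1 (subst (p ^ ν p L ∣_) ℓ≡1 (p^ν∣ℓ g L p-prime p∤g p∣L)))
  ...   | inj₁ ν≡0 = contradiction ν≡0 (>⇒≢ (p∣n⇒1≤ν (prime⇒1<p p-prime) p∣L))
  ...   | inj₂ p≡1 = contradiction p≡1 (>⇒≢ (prime⇒1<p p-prime))

  prime∣prime⇒≡ : ∀ {p q} → Prime p → Prime q → p ∣ q → p ≡ q
  prime∣prime⇒≡ p-prime q-prime p∣q with prime⇒irreducible q-prime p∣q
  ... | inj₁ refl = contradiction p-prime ¬prime[1]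
  ... | inj₂ p≡q  = p≡q

  p^k∣m*n∧p∤m⇒p^k∣n : ∀ {p m n} k → Prime p → ¬ p ∣ m → p ^ k ∣ m * n → p ^ k ∣ n
  p^k∣m*n∧p∤m⇒p^k∣n zero _ _ _ = 1∣ _
  p^k∣m*n∧p∤m⇒p^k∣n {p} {m} {n} (suc k) p-prime p∤m p^[1+k]∣mn
    with euclidsLemma m n p-prime (∣-trans (m∣m*n (p ^ k)) p^[1+k]∣mn)
  ... | inj₁ p∣m = contradiction p∣m p∤m
  ... | inj₂ p∣n = begin
    p * p ^ k   ∣⟨ *-monoʳ-∣ p (p^k∣m*n∧p∤m⇒p^k∣n k p-prime p∤m p^k∣mn′) ⟩
    p * n′      ≡⟨ n≡pn′ ⟨
    n           ∎
    where
    open ∣-Reasoning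
    n′ : ℕ
    n′ = quotient p∣n
    n≡pn′ : n ≡ p * n′
    n≡pn′ = m∣n⇒n≡m*quotient p∣n
    p^k∣mn′ : p ^ k ∣ m * n′
    p^k∣mn′ = *-cancelˡ-∣ p {{prime⇒nonZero p-prime}} (begin
      p * p ^ k       ∣⟨ p^[1+k]∣mn ⟩
      m * n           ≡⟨ cong (m *_) n≡pn′ ⟩
      m * (p * n′)    ≡⟨ x∙yz≈y∙xz m p n′ ⟩
      p * (m * n′)    ∎)

  PrimePowersDivide : ℕ → ℕ → Set
  PrimePowersDivide n m = ∀ {p} k → Prime p → p ^ k ∣ n → p ^ k ∣ m

  productOfPrimes-∣ : ∀ {as m} → All Prime as → PrimePowersDivide (product as) m →
                      product as ∣ m
  productOfPrimes-∣ {[]}     _                  _     = 1∣ _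
  productOfPrimes-∣ {p ∷ as} {m} (p-prime ∷ ps) local = begin
    p * product as   ∣⟨ *-monoʳ-∣ p (productOfPrimes-∣ ps local′) ⟩
    p * m′           ≡⟨ m≡pm′ ⟨
    m                ∎
    where
    open ∣-Reasoning
    p∣m : p ∣ m
    p∣m = subst (_∣ m) (^-identityʳ p) (local 1 p-prime (*-monoʳ-∣ p (1∣ _)))
    m′ : ℕ
    m′ = quotient p∣m
    m≡pm′ : m ≡ p * m′
    m≡pm′ = m∣n⇒n≡m*quotient p∣m
    local′ : PrimePowersDivide (product as) m′
    local′ {r} k r-prime r^k∣as with r ≟ p
    ... | yes refl = *-cancelˡ-∣ p {{prime⇒nonZero p-prime}}
      (subst (p ^ suc k ∣_) m≡pm′ (local (suc k) p-prime (*-monoʳ-∣ p r^k∣as)))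
    ... | no  r≢p  = p^k∣m*n∧p∤m⇒p^k∣n k r-prime (r≢p ∘ prime∣prime⇒≡ r-prime p-prime)
      (subst (r ^ k ∣_) m≡pm′ (local k r-prime (∣n⇒∣m*n p r^k∣as)))

  primePowersDivide⇒∣ : ∀ {n m} .{{_ : NonZero n}} → PrimePowersDivide n m → n ∣ m
  primePowersDivide⇒∣ {n} {m} local =
    subst (_∣ m) (sym isFactorisation) (productOfPrimes-∣ factorsPrime
      λ k p-prime → local k p-prime ∘ subst (_ ∣_) (sym isFactorisation))
    where open PrimeFactorisation (factorise n)

  γ≤K⇒ν≤ν*K : ∀ {p} g L {K} .{{_ : NonZero g}} → Prime p → p ∣ g → γ g L ≤ K →
               ν p L ≤ ν p g * K
  γ≤K⇒ν≤ν*K {p} g L {K} p-prime p∣g γ≤K = begin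
    ν p L                       ≤⟨ m≤⌈m/n⌉*n (ν p L) (ν p g) ⟩
    ⌈ ν p L / ν p g ⌉ * ν p g   ≤⟨ *-monoˡ-≤ (ν p g) (≤-trans (⌈ν/ν⌉≤γ g L p-prime p∣g) γ≤K) ⟩
    K * ν p g                   ≡⟨ *-comm K (ν p g) ⟩
    ν p g * K                   ∎
    where
    open ≤-Reasoning
    instance
      νg≢0 : NonZero (ν p g)
      νg≢0 = >-nonZero (p∣n⇒1≤ν (prime⇒1<p p-prime) p∣g)

  ℓ≡1∧γ≤K⇒L∣g^K : ∀ g L {K} .{{_ : NonZero g}} .{{_ : NonZero L}} →
                  ℓ g L ≡ 1 → γ g L ≤ K → L ∣ g ^ K
  ℓ≡1∧γ≤K⇒L∣g^K g L {K} ℓ≡1 γ≤K = primePowersDivide⇒∣ prime-power-∣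
    where
    prime-power-∣ : PrimePowersDivide L (g ^ K)
    prime-power-∣ zero    _       _       = 1∣ _
    prime-power-∣ {p} (suc k) p-prime p^[1+k]∣L = begin
      p ^ suc k         ∣⟨ ^-monoʳ-∣ p {suc k} (≤-trans 1+k≤ν ν≤ν*K) ⟩
      p ^ (ν p g * K)   ≡⟨ ^-*-assoc p (ν p g) K ⟨
      (p ^ ν p g) ^ K   ∣⟨ ^-monoˡ-∣ K (p^ν∣n p g) ⟩
      g ^ K             ∎
      where
      open ∣-Reasoning
      p∣g : p ∣ g
      p∣g = ℓ≡1⇒∣g g L ℓ≡1 p-prime (∣-trans (m∣m*n (p ^ k)) p^[1+k]∣L)
      1+k≤ν : suc k ≤ ν p L
      1+k≤ν = p^k∣n⇒k≤ν (prime⇒1<p p-prime) p^[1+k]∣L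
      ν≤ν*K : ν p L ≤ ν p g * K
      ν≤ν*K = γ≤K⇒ν≤ν*K g L p-prime p∣g γ≤K

  abs-^ : ∀ i n → ℤ.∣ i ℤ.^ n ∣ ≡ ℤ.∣ i ∣ ^ n
  abs-^ i zero    = refl
  abs-^ i (suc n) = trans (ℤ.abs-* i (i ℤ.^ n)) (cong (ℤ.∣ i ∣ *_) (abs-^ i n))

  gcdℤ-nonZero : ∀ {A} B → A ≢ ℤ.+ 0 → NonZero (gcdℤ A B)
  gcdℤ-nonZero {A} B A≢0 = ≢-nonZero (gcd[m,n]≢0 ℤ.∣ A ∣ ℤ.∣ B ∣ (inj₁ (A≢0 ∘ ℤ.∣i∣≡0⇒i≡0)))

  ∣gcdℤ^K⇒∣A^K+B^K : ∀ A B {L} K → L ∣ gcdℤ A B ^ K → ℤ.+ L ℤ.∣ A ℤ.^ K ℤ.+ B ℤ.^ K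
  ∣gcdℤ^K⇒∣A^K+B^K A B {L} K L∣g^K = ℤˢ.∣⇒∣ᵤ (ℤˢ.∣m∣n⇒∣m+n
    (divides-power A (gcd[m,n]∣m ℤ.∣ A ∣ ℤ.∣ B ∣))
    (divides-power B (gcd[m,n]∣n ℤ.∣ A ∣ ℤ.∣ B ∣)))
    where
    divides-power : ∀ C → gcdℤ A B ∣ ℤ.∣ C ∣ → ℤ.+ L ℤˢ.∣ C ℤ.^ K
    divides-power C g∣C =
      ℤˢ.∣ᵤ⇒∣ (subst (L ∣_) (sym (abs-^ C K)) (∣-trans L∣g^K (^-monoˡ-∣ K g∣C)))

open import Data.Integer using (ℤ; +_; _^_; _+_)
open import Data.Integer.Divisibility using (_∣_)

corollary3p11 : (A B : ℤ) → A ≢ + 0 → B ≢ + 0 → (L : ℕ) → 1 ≤ L →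
                ℓ (gcdℤ A B) L ≡ 1 →
                (Good A B L ⇔ (∃ λ K → 1 ≤ K × γ (gcdℤ A B) L ≤ K))
                × Good A B L
                × ((K : ℕ) → 1 ≤ K → γ (gcdℤ A B) L ≤ K → (+ L) ∣ (A ^ K + B ^ K))
corollary3p11 A B A≢0 _ L 1≤L ℓ≡1 = mk⇔ (λ _ → K₀ , 1≤K₀ , γ≤K₀) (λ _ → good) , good , divides
  where
  instance
    g≢0 : NonZero (gcdℤ A B)
    g≢0 = gcdℤ-nonZero B A≢0
    L≢0 : NonZero L
    L≢0 = >-nonZero 1≤L
  divides : (K : ℕ) → 1 ≤ K → γ (gcdℤ A B) L ≤ K → (+ L) ∣ (A ^ K + B ^ K)
  divides K _ γ≤K = ∣gcdℤ^K⇒∣A^K+B^K A B K (ℓ≡1∧γ≤K⇒L∣g^K (gcdℤ A B) L ℓ≡1 γ≤K)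
  K₀ : ℕ
  K₀ = suc (γ (gcdℤ A B) L)
  1≤K₀ : 1 ≤ K₀
  1≤K₀ = s≤s z≤n
  γ≤K₀ : γ (gcdℤ A B) L ≤ K₀
  γ≤K₀ = n≤1+n _
  good : Good A B L
  good = K₀ , 1≤K₀ , divides K₀ 1≤K₀ γ≤K₀
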